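{- Let $n\ge1$ and $v=(x_1,\dots,x_n)\in([-1,1]\setminus\{0\})^n$. Then the set $K_v$ has a good partition, i.e. there is a partition $\eta_v$ of $K_v$ such that every block $p\in\eta_v$ is of one of the following forms: (1) $p=\{(i,j)\}$ with $s(i,j)=1$; (2) $p=\{(i,j),(i',j')\}$ with $s(i,j)=1$, $s(i',j')=-1$, and either ($i'\le i$ and $j=j'$) or ($i'=i$ and $j\le j'$); (3) $p=\{(i,j),(i-l,j),(i,j+l'),(i-l,j+l')\}$ with $l,l'\ge1$, $s(i,j)=s(i-l,j+l')=1$ and $s(i-l,j)=s(i,j+l')=-1$; (4) $p=\{(i,j)\}$ with $s(i,j)=-1$; (5) $p=\{(i,j),(i+l,j),(i,j-l')\}$ with $l,l'\ge 1$, $s(i,j)=1$ and $s(i+l,j)=s(i,j-l')=-1$; and moreover the number of blocks of $\eta_v$ of form (4) or (5) equals $\min(\alpha+1,\beta)$.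
   Context: For $v=(x_1,\dots,x_n)\in([-1,1]\setminus\{0\})^n$ and $1\le i\le j\le n$, set $a_{v(i,j)}:=1-\prod_{k=i}^j x_k$ and define the product sign $s(i,j)=s(a_{v(i,j)}):=\prod_{k=i}^j \operatorname{sign}(x_k)\in\{1,-1\}$. The set of canonical indices is $K_v:=\{(i,j): 1\le i\le j\le n,\ s(i,j)=(-1)^{i+j+1}\}$. Let $\alpha$ be the number of indices $i\in\{1,\dots,n\}$ with $\prod_{k=1}^i x_k>0$ and $\beta$ the number of indices $i\in\{1,\dots,n\}$ with $\prod_{k=1}^i x_k<0$. All pairs appearing in blocks of the partition are elements of $K_v$. -}

module Defs where

open import Data.Nat using (ℕ; zero; suc; _+_; _∸_; _≤_; _<_; _⊓_)
open import Data.Sign using (Sign; _*_) renaming (+ to pos; - to neg)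
import Data.Sign as S
open import Data.Vec using (Vec; []; _∷_)
open import Data.List using (List; []; _∷_; length; filter; map; upTo; concatMap)
open import Data.List.Membership.Propositional using (_∈_)
open import Data.List.Relation.Unary.All using (All)
open import Data.List.Relation.Unary.Unique.Propositional using (Unique)
open import Data.Product using (_×_; _,_; proj₁; proj₂)
open import Data.Sum using (_⊎_)
open import Relation.Binary.PropositionalEquality using (_≡_)
open import Relation.Nullary using (Dec; yes; no)
open import Relation.Nullary.Decidable using (does)
open import Data.Bool using (Bool; true; false; if_then_else_)

-- A point v = (x₁,…,xₙ) ∈ ([-1,1]∖{0})ⁿ enters the statement only through the
-- signs sign(x_k); we therefore represent v by its sign vector.

-- 1-based access: at x k = sign(x_k) for 1 ≤ k ≤ n (value + outside this range,
-- never used for pairs in K_v).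
at0 : ∀ {n} → Vec Sign n → ℕ → Sign
at0 []      _       = pos
at0 (s ∷ v) zero    = s
at0 (s ∷ v) (suc k) = at0 v k

at : ∀ {n} → Vec Sign n → ℕ → Sign
at v zero    = pos
at v (suc k) = at0 v k

prodFrom : ∀ {n} → Vec Sign n → ℕ → ℕ → Sign
prodFrom x i zero    = pos
prodFrom x i (suc m) = at x i * prodFrom x (suc i) m

s : ∀ {n} → Vec Sign n → ℕ → ℕ → Sign
s x i j = prodFrom x i (suc j ∸ i)

minusOnePow : ℕ → Sign
minusOnePow zero    = pos
minusOnePow (suc m) = neg * minusOnePow m

Pair : Set
Pair = ℕ × ℕ

InK : ∀ {n} → Vec Sign n → Pair → Set
InK {n} x (i , j) = (1 ≤ i) × (i ≤ j) × (j ≤ n) × (s x i j ≡ minusOnePow (i + j + 1))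

indices : ℕ → List ℕ
indices n = map suc (upTo n)

α : ∀ {n} → Vec Sign n → ℕ
α {n} x = length (filter (λ i → s x 1 i S.≟ pos) (indices n))

β : ∀ {n} → Vec Sign n → ℕ
β {n} x = length (filter (λ i → s x 1 i S.≟ neg) (indices n))

data Form : Set where
  f1 f2 f3 f4 f5 : Form

is45 : Form → Bool
is45 f4 = true
is45 f5 = true
is45 _  = false

data HasForm {n} (x : Vec Sign n) : Form → List Pair → Set where
  form1 : ∀ i j → s x i j ≡ pos → HasForm x f1 ((i , j) ∷ [])
  form2 : ∀ i j i' j' → s x i j ≡ pos → s x i' j' ≡ neg →
          ((i' ≤ i) × (j ≡ j')) ⊎ ((i' ≡ i) × (j ≤ j')) →
          HasForm x f2 ((i , j) ∷ (i' , j') ∷ [])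
  form3 : ∀ i j l l' → 1 ≤ l → 1 ≤ l' → l < i →
          s x i j ≡ pos → s x (i ∸ l) (j + l') ≡ pos →
          s x (i ∸ l) j ≡ neg → s x i (j + l') ≡ neg →
          HasForm x f3 ((i , j) ∷ (i ∸ l , j) ∷ (i , j + l') ∷ (i ∸ l , j + l') ∷ [])
  form4 : ∀ i j → s x i j ≡ neg → HasForm x f4 ((i , j) ∷ [])
  form5 : ∀ i j l l' → 1 ≤ l → 1 ≤ l' → l' ≤ j →
          s x i j ≡ pos → s x (i + l) j ≡ neg → s x i (j ∸ l') ≡ neg →
          HasForm x f5 ((i , j) ∷ (i + l , j) ∷ (i , j ∸ l') ∷ [])

Block : Set
Block = Form × List Pair

record GoodPartition {n} (x : Vec Sign n) : Set where
  field
    blocks    : List Block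
    forms     : All (λ b → HasForm x (proj₁ b) (proj₂ b)) blocks
    disjoint  : Unique (concatMap proj₂ blocks)
    sound     : ∀ p → p ∈ concatMap proj₂ blocks → InK x p
    complete  : ∀ p → InK x p → p ∈ concatMap proj₂ blocks
    count45   : length (filter (λ b → is45 (proj₁ b) Data.Bool.≟ true) blocks)
                ≡ (α x + 1) ⊓ β x

module Submission where

-- Write σₖ = sign(x₁⋯xₖ), so σ₀ = +, and read σ as a lattice walk with steps k = 0, …, n: step k
-- goes up iff σₖ = +, and its level is the lower of its two heights. Since s(i,j) = σᵢ₋₁σⱼ and the
-- level of step k has the parity of k + [σₖ = −], a pair (i,j) is canonical iff the steps i − 1 and j
-- lie at levels of equal parity, and s(i,j) = 1 iff these steps go in the same direction.
-- Consecutive crossings of a level alternate in direction.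
--
-- Call equally directed steps u < v inner if v lies strictly beyond u in their direction of travel,
-- or at the same level when u moves towards 0. An inner pair spans a block with the previous
-- crossing of u's level and the next crossing of v's level (forms 1–3); a step y moving towards 0
-- spans a block with the neighbouring crossings of its level (forms 4–5). From a canonical pair one
-- can compute the block containing it, which makes the blocks disjoint, and a case analysis on
-- directions and levels shows that they cover K_v. Finally, a walk with U up-steps and D down-steps
-- makes exactly min(U, D) steps towards 0, and here U = α + 1 (step 0 goes up) and D = β.

open import Defs
open import Data.Nat using (ℕ; _≤_)
open import Data.Sign using (Sign)
open import Data.Vec using (Vec)

open import Data.Bool using (Bool; true; false; not; T; if_then_else_)
import Data.Bool.Properties as Bool
open import Data.Empty using (⊥; ⊥-elim)
open import Data.Unit using (tt)
open import Relation.Binary.Definitions using (tri<; tri≈; tri>)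
open import Data.Integer as ℤ using (ℤ; +_; -[1+_]; 0ℤ; _⊖_)
import Data.Integer.Properties as ℤ
open import Data.List
  using (List; []; _∷_; _++_; [_]; length; filter; map; concat; concatMap; upTo; cartesianProduct)
import Data.List.Properties as List
open import Data.List.Membership.Propositional using (_∈_; find; lose)
open import Data.List.Membership.Propositional.Properties
  using (∈-++⁺ˡ; ∈-++⁺ʳ; ∈-++⁻; ∈-map⁺; ∈-map⁻; ∈-filter⁺; ∈-filter⁻; ∈-upTo⁺; ∈-upTo⁻;
         ∈-concatMap⁺; ∈-concatMap⁻; ∈-cartesianProduct⁺)
open import Data.List.Relation.Unary.All using ([]; _∷_)
import Data.List.Relation.Unary.All as All
import Data.List.Relation.Unary.All.Properties as All
open import Data.List.Relation.Unary.Any using (here; there)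
import Data.List.Relation.Unary.Any.Properties as Any
open import Data.List.Relation.Unary.AllPairs using ([]; _∷_)
open import Data.List.Relation.Unary.Unique.Propositional using (Unique)
open import Data.List.Relation.Binary.Disjoint.Propositional using (Disjoint)
import Data.List.Relation.Unary.Unique.Propositional.Properties as Unique
open import Data.Maybe using (Maybe; just; nothing; fromMaybe; _<∣>_)
open import Data.Maybe.Properties using (just-injective)
open import Data.Nat as ℕ using (zero; suc; _+_; _∸_; _<_; _⊓_; z≤n; s≤s; _<?_; _≤?_)
import Data.Nat.Properties as ℕ
open import Data.Product using (_×_; _,_; proj₁; proj₂; ∃-syntax; uncurry)
open import Data.Sign as Sign using (opposite; _*_) renaming (+ to pos; - to neg)
import Data.Sign.Properties as Sign
open import Data.Sum using (_⊎_; inj₁; inj₂)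
open import Function using (_∘_; _⇔_; mk⇔; Equivalence)
import Function.Properties.Equivalence as ⇔
open import Relation.Binary.PropositionalEquality hiding ([_])
open import Relation.Nullary using (¬_; Dec; yes; no; does)
open import Relation.Nullary.Decidable using (_×-dec_; _⊎-dec_; T?; map′; dec-yes; dec-no)
open import Relation.Unary using (Pred; Decidable)

sign-cases : ∀ s → s ≡ pos ⊎ s ≡ neg
sign-cases pos = inj₁ refl
sign-cases neg = inj₂ refl

minusOnePow-+ : ∀ a b → minusOnePow (a + b) ≡ minusOnePow a * minusOnePow b
minusOnePow-+ zero    b = refl
minusOnePow-+ (suc a) b = trans (cong (neg *_) (minusOnePow-+ a b))
                                (sym (Sign.*-assoc neg (minusOnePow a) (minusOnePow b)))

*-transpose : ∀ s t u v → s * t ≡ u * v → s * u ≡ t * v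
*-transpose s t u v e = Sign.*-cancelˡ-≡ t (s * u) (t * v) (begin
  t * (s * u)  ≡⟨ Sign.*-assoc t s u ⟨
  (t * s) * u  ≡⟨ cong (_* u) (trans (Sign.*-comm t s) e) ⟩
  (u * v) * u  ≡⟨ trans (cong (_* u) (Sign.*-comm u v)) (Sign.*-assoc v u u) ⟩
  v * (u * u)  ≡⟨ trans (cong (v *_) (Sign.s*s≡+ u)) (Sign.*-identityʳ v) ⟩
  v            ≡⟨ cong (_* v) (Sign.s*s≡+ t) ⟨
  (t * t) * v  ≡⟨ Sign.*-assoc t t v ⟩
  t * (t * v)  ∎)
  where open ≡-Reasoning

≡opposite-sym : ∀ {s t} → s ≡ opposite t → t ≡ opposite s
≡opposite-sym {t = t} refl = sym (Sign.opposite-involutive t)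

≡opposite-sym′ : ∀ {s t r} → s ≡ opposite t → s ≡ r → t ≡ opposite r
≡opposite-sym′ e refl = ≡opposite-sym e

≡opposite⇒≢ : ∀ {s t} → s ≡ opposite t → s ≢ t
≡opposite⇒≢ {t = t} refl = Sign.s≢opposite[s] t ∘ sym

≢⇒≡opposite : ∀ {s t} → s ≢ t → s ≡ opposite t
≢⇒≡opposite {pos} {pos} s≢t = ⊥-elim (s≢t refl)
≢⇒≡opposite {pos} {neg} _   = refl
≢⇒≡opposite {neg} {pos} _   = refl
≢⇒≡opposite {neg} {neg} s≢t = ⊥-elim (s≢t refl)

does⇔ : ∀ {P : Set} (P? : Dec P) → T (does P?) ⇔ P
does⇔ (yes p)  = mk⇔ (λ _ → p) (λ _ → tt)
does⇔ (no ¬p)  = mk⇔ (λ ()) ¬p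

not-does⇔ : ∀ {P : Set} (P? : Dec P) → T (not (does P?)) ⇔ (¬ P)
not-does⇔ (yes p) = mk⇔ (λ ()) (λ ¬p → ¬p p)
not-does⇔ (no ¬p) = mk⇔ (λ _ → ¬p) (λ _ → tt)

parity : ℤ → Sign
parity z = minusOnePow ℤ.∣ z ∣

parity-suc : ∀ z → parity (ℤ.suc z) ≡ opposite (parity z)
parity-suc (+ m)            = refl
parity-suc -[1+ zero ]      = refl
parity-suc -[1+ suc m ]     = sym (Sign.opposite-involutive _)

parity-pred : ∀ z → parity (ℤ.pred z) ≡ opposite (parity z)
parity-pred z = begin
  parity (ℤ.pred z)                       ≡⟨ Sign.opposite-involutive _ ⟨
  opposite (opposite (parity (ℤ.pred z))) ≡⟨ cong opposite (parity-suc (ℤ.pred z)) ⟨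
  opposite (parity (ℤ.suc (ℤ.pred z)))    ≡⟨ cong (opposite ∘ parity) (ℤ.suc-pred z) ⟩
  opposite (parity z)                     ∎
  where open ≡-Reasoning

m⊖n<0 : ∀ {m n} → m < n → m ⊖ n ℤ.< 0ℤ
m⊖n<0 {zero}  {suc n} _         = ℤ.-<+
m⊖n<0 {suc m} {suc n} (s≤s m<n) = subst (ℤ._< 0ℤ) (sym (ℤ.[1+m]⊖[1+n]≡m⊖n m n)) (m⊖n<0 m<n)

m⊖n≮0 : ∀ {m n} → n ≤ m → ¬ (m ⊖ n ℤ.< 0ℤ)
m⊖n≮0 n≤m m⊖n<0 with ℤ.+<+ () ← subst (ℤ._< 0ℤ) (ℤ.⊖-≥ n≤m) m⊖n<0

m⊖n<0⇔m<n : ∀ {m n} → (m ⊖ n ℤ.< 0ℤ) ⇔ m < n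
m⊖n<0⇔m<n {m} {n} = mk⇔ (λ lt → ℕ.≰⇒> (λ n≤m → m⊖n≮0 n≤m lt)) m⊖n<0

i<suc[i] : ∀ i → i ℤ.< ℤ.suc i
i<suc[i] i = ℤ.suc[i]≤j⇒i<j ℤ.≤-refl

pred[i]<i : ∀ i → ℤ.pred i ℤ.< i
pred[i]<i i = ℤ.i≤pred[j]⇒i<j ℤ.≤-refl

squeeze : ∀ {c z} → c ℤ.< ℤ.suc z → z ℤ.≤ c → c ≡ z
squeeze {c} {z} c<1+z z≤c =
  ℤ.≤-antisym (subst (c ℤ.≤_) (ℤ.pred-suc z) (ℤ.i<j⇒i≤pred[j] c<1+z)) z≤c

⊓-suc-< : ∀ {m n} → m < n → suc m ⊓ n ≡ suc (m ⊓ n)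
⊓-suc-< m<n = trans (ℕ.m≤n⇒m⊓n≡m m<n) (cong suc (sym (ℕ.m≤n⇒m⊓n≡m (ℕ.<⇒≤ m<n))))

⊓-suc-≥ : ∀ {m n} → n ≤ m → suc m ⊓ n ≡ m ⊓ n
⊓-suc-≥ n≤m = trans (ℕ.m≥n⇒m⊓n≡n (ℕ.m≤n⇒m≤1+n n≤m)) (sym (ℕ.m≥n⇒m⊓n≡n n≤m))

module Count {p} {P : Pred ℕ p} (P? : Decidable P) where

  count : ℕ → ℕ
  count m = length (filter P? (upTo m))

  count-suc : ∀ m → count (suc m) ≡ count m + length (filter P? [ m ])
  count-suc m = begin
    length (filter P? (upTo (suc m)))                ≡⟨ cong (length ∘ filter P?) (List.upTo-∷ʳ m) ⟨
    length (filter P? (upTo m ++ [ m ]))             ≡⟨ cong length (List.filter-++ P? (upTo m) [ m ]) ⟩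
    length (filter P? (upTo m) ++ filter P? [ m ])   ≡⟨ List.length-++ (filter P? (upTo m)) ⟩
    count m + length (filter P? [ m ])               ∎
    where open ≡-Reasoning

  count-accept : ∀ {m} → P m → count (suc m) ≡ suc (count m)
  count-accept {m} pm = trans (count-suc m)
    (trans (cong (λ xs → count m + length xs) (List.filter-accept P? pm)) (ℕ.+-comm (count m) 1))

  count-reject : ∀ {m} → ¬ P m → count (suc m) ≡ count m
  count-reject {m} ¬pm = trans (count-suc m)
    (trans (cong (λ xs → count m + length xs) (List.filter-reject P? ¬pm)) (ℕ.+-identityʳ (count m)))

  count-suc-⊓ : ∀ {m} k l → (P m ⇔ k < l) → count m ≡ k ⊓ l → count (suc m) ≡ suc k ⊓ l
  count-suc-⊓ k l P⇔< c≡ with k <? l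
  ... | yes k<l = trans (count-accept (Equivalence.from P⇔< k<l)) (trans (cong suc c≡) (sym (⊓-suc-< k<l)))
  ... | no  k≮l = trans (count-reject (k≮l ∘ Equivalence.to P⇔<)) (trans c≡ (sym (⊓-suc-≥ (ℕ.≮⇒≥ k≮l))))

open Count public using (count)

<-≤-bounded : ∀ {m n o} → m < o → o ≤ m + (n ∸ m) → o ≤ n
<-≤-bounded {m} {n} m<o o≤ with m ≤? n
... | yes m≤n = subst (_≤_ _) (ℕ.m+[n∸m]≡n m≤n) o≤
... | no  m≰n = ⊥-elim (ℕ.<⇒≱ m<o (subst (_≤_ _)
                   (trans (cong (_+_ m) (ℕ.m≤n⇒m∸n≡0 (ℕ.≰⇒≥ m≰n))) (ℕ.+-identityʳ m)) o≤))

≤-+∸ : ∀ {m n o} → m ≤ o → o ≤ n → o ≤ m + (n ∸ m)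
≤-+∸ {m} {n} m≤o o≤n = subst (_≤_ _) (sym (ℕ.m+[n∸m]≡n (ℕ.≤-trans m≤o o≤n))) o≤n

Unique-concatMap⁺ : ∀ {A B : Set} {f : A → List B} (owner : B → A) {xs : List A} → Unique xs →
                    (∀ {a} → a ∈ xs → Unique (f a)) → (∀ {a b} → a ∈ xs → b ∈ f a → owner b ≡ a) →
                    Unique (concatMap f xs)
Unique-concatMap⁺ owner {[]}     _            _       _   = []
Unique-concatMap⁺ {f = f} owner {a ∷ as} (a∉as ∷ !as) !f owns =
  Unique.++⁺ (!f (here refl)) (Unique-concatMap⁺ owner !as (!f ∘ there) (owns ∘ there)) disjoint
  where
  disjoint : Disjoint (f a) (concatMap f as)
  disjoint (b∈fa , b∈rest) with a′ , a′∈as , b∈fa′ ← find (∈-concatMap⁻ f b∈rest) =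
    All.lookup a∉as a′∈as (trans (sym (owns (here refl) b∈fa)) (owns (there a′∈as) b∈fa′))

≢-fst : ∀ {i i′ j j′ : ℕ} → i ≢ i′ → (i , j) ≢ (i′ , j′)
≢-fst i≢i′ = i≢i′ ∘ cong proj₁

≢-snd : ∀ {i i′ j j′ : ℕ} → j ≢ j′ → (i , j) ≢ (i′ , j′)
≢-snd j≢j′ = j≢j′ ∘ cong proj₂

suc-≢ : ∀ {a b} → a < b → suc a ≢ suc b
suc-≢ a<b = ℕ.<⇒≢ a<b ∘ ℕ.suc-injective

<-suc-cases : ∀ {k m} → k < suc m → k < m ⊎ k ≡ m
<-suc-cases k<1+m = ℕ.m≤n⇒m<n∨m≡n (ℕ.≤-pred k<1+m)

module BoundedSearch {p} {P : Pred ℕ p} (P? : Decidable P) where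

  NoneBetween : ℕ → ℕ → Set p
  NoneBetween u v = ∀ k → u < k → k < v → ¬ P k

  lastBelow : ℕ → Maybe ℕ
  lastBelow zero    = nothing
  lastBelow (suc m) with P? m
  ... | yes _ = just m
  ... | no  _ = lastBelow m

  lastBelow-just : ∀ {m u} → lastBelow m ≡ just u → u < m × P u × NoneBetween u m
  lastBelow-just {suc m} e with P? m
  lastBelow-just {suc m} refl | yes pm =
    ℕ.≤-refl , pm , λ k m<k k<1+m _ → ℕ.<⇒≱ m<k (ℕ.≤-pred k<1+m)
  ... | no ¬pm with u<m , pu , none ← lastBelow-just {m} e =
    ℕ.m≤n⇒m≤1+n u<m , pu , none′
    where
    none′ : NoneBetween _ (suc m)
    none′ k u<k k<1+m with <-suc-cases k<1+m
    ... | inj₁ k<m  = none k u<k k<m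
    ... | inj₂ refl = ¬pm

  lastBelow-exists : ∀ {m k} → k < m → P k → ∃[ u ] lastBelow m ≡ just u × k ≤ u
  lastBelow-exists {suc m} k<1+m pk with P? m
  ... | yes _  = m , refl , ℕ.≤-pred k<1+m
  ... | no ¬pm with <-suc-cases k<1+m
  ...   | inj₁ k<m  = lastBelow-exists k<m pk
  ...   | inj₂ refl = ⊥-elim (¬pm pk)

  lastBelow-unique : ∀ {m u} → u < m → P u → NoneBetween u m → lastBelow m ≡ just u
  lastBelow-unique u<m pu none with u′ , e , u≤u′ ← lastBelow-exists u<m pu
    with u′<m , pu′ , _ ← lastBelow-just e with ℕ.m≤n⇒m<n∨m≡n u≤u′
  ... | inj₁ u<u′ = ⊥-elim (none _ u<u′ u′<m pu′)
  ... | inj₂ refl = e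

  firstAbove : ℕ → ℕ → Maybe ℕ
  firstAbove y zero    = nothing
  firstAbove y (suc c) with P? (suc y)
  ... | yes _ = just (suc y)
  ... | no  _ = firstAbove (suc y) c

  firstAbove-just : ∀ {y c v} → firstAbove y c ≡ just v → y < v × v ≤ y + c × P v × NoneBetween y v
  firstAbove-just {y} {suc c} e with P? (suc y)
  firstAbove-just {y} {suc c} refl | yes pv =
    ℕ.≤-refl , subst (suc y ≤_) (sym (ℕ.+-suc y c)) (s≤s (ℕ.m≤m+n y c)) , pv ,
    λ k y<k k<1+y _ → ℕ.<⇒≱ y<k (ℕ.≤-pred k<1+y)
  ... | no ¬p with 1+y<v , v≤ , pv , none ← firstAbove-just {suc y} {c} e =
    ℕ.<⇒≤ 1+y<v , subst (_≤_ _) (sym (ℕ.+-suc y c)) v≤ , pv , none′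
    where
    none′ : NoneBetween y _
    none′ k y<k k<v with ℕ.m≤n⇒m<n∨m≡n y<k
    ... | inj₁ 1+y<k = none k 1+y<k k<v
    ... | inj₂ refl  = ¬p

  firstAbove-exists : ∀ {y c k} → y < k → k ≤ y + c → P k → ∃[ v ] firstAbove y c ≡ just v × v ≤ k
  firstAbove-exists {y} {zero}  y<k k≤y _ = ⊥-elim (ℕ.<⇒≱ y<k (subst (_≤_ _) (ℕ.+-identityʳ y) k≤y))
  firstAbove-exists {y} {suc c} y<k k≤ pk with P? (suc y)
  ... | yes _ = suc y , refl , y<k
  ... | no ¬p with ℕ.m≤n⇒m<n∨m≡n y<k
  ...   | inj₁ 1+y<k = firstAbove-exists 1+y<k (subst (_≤_ _) (ℕ.+-suc y c) k≤) pk
  ...   | inj₂ refl  = ⊥-elim (¬p pk)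

  firstAbove-unique : ∀ {y c v} → y < v → v ≤ y + c → P v → NoneBetween y v → firstAbove y c ≡ just v
  firstAbove-unique {y} {c} y<v v≤ pv none with v′ , e , v′≤v ← firstAbove-exists {y} {c} y<v v≤ pv
    with y<v′ , _ , pv′ , _ ← firstAbove-just {y} {c} e with ℕ.m≤n⇒m<n∨m≡n v′≤v
  ... | inj₁ v′<v = ⊥-elim (none _ y<v′ v′<v pv′)
  ... | inj₂ refl = e

module Walk (n : ℕ) (σ : ℕ → Sign) where

  up? : Decidable (λ k → σ k ≡ pos)
  up? k = σ k Sign.≟ pos

  down? : Decidable (λ k → σ k ≡ neg)
  down? k = σ k Sign.≟ neg

  ups downs : ℕ → ℕ
  ups   = count up?
  downs = count down?

  height : ℕ → ℤ
  height k = ups k ⊖ downs k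

  lowerEnd : Sign → ℤ → ℤ
  lowerEnd pos z = z
  lowerEnd neg z = ℤ.pred z

  level : ℕ → ℤ
  level k = lowerEnd (σ k) (height k)

  height-up : ∀ {k} → σ k ≡ pos → height (suc k) ≡ ℤ.suc (height k)
  height-up {k} up = begin
    ups (suc k) ⊖ downs (suc k)  ≡⟨ cong₂ _⊖_ (Count.count-accept up? up)
                                               (Count.count-reject down? (≡opposite⇒≢ up)) ⟩
    suc (ups k) ⊖ downs k        ≡⟨ ℤ.distribʳ-⊖-+-pos 1 (ups k) (downs k) ⟨
    ℤ.suc (height k)             ∎
    where open ≡-Reasoning

  height-down : ∀ {k} → σ k ≡ neg → height (suc k) ≡ ℤ.pred (height k)
  height-down {k} down = begin
    ups (suc k) ⊖ downs (suc k)  ≡⟨ cong₂ _⊖_ (Count.count-reject up? (≡opposite⇒≢ down))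
                                               (Count.count-accept down? down) ⟩
    ups k ⊖ suc (downs k)        ≡⟨ ℤ.distribʳ-⊖-+-neg 0 (ups k) (downs k) ⟨
    ℤ.pred (height k)            ∎
    where open ≡-Reasoning

  up-start : ∀ {k} → σ k ≡ pos → height k ≡ level k
  up-start up rewrite up = refl

  up-end : ∀ {k} → σ k ≡ pos → height (suc k) ≡ ℤ.suc (level k)
  up-end up rewrite up = height-up up

  down-start : ∀ {k} → σ k ≡ neg → height k ≡ ℤ.suc (level k)
  down-start {k} down rewrite down = sym (ℤ.suc-pred (height k))

  down-end : ∀ {k} → σ k ≡ neg → height (suc k) ≡ level k
  down-end down rewrite down = height-down down

  level<up-end : ∀ {k} → σ k ≡ pos → level k ℤ.< height (suc k)
  level<up-end {k} up = subst (level k ℤ.<_) (sym (up-end up)) (i<suc[i] (level k))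

  level<down-start : ∀ {k} → σ k ≡ neg → level k ℤ.< height k
  level<down-start {k} down = subst (level k ℤ.<_) (sym (down-start down)) (i<suc[i] (level k))

  Crossing : ℕ → ℕ → Sign → ℤ → Set
  Crossing a b s c = ∃[ k ] a ≤ k × k < b × σ k ≡ s × level k ≡ c

  up-crossing : ∀ {a b c} → a ≤ b → height a ℤ.≤ c → c ℤ.< height b → Crossing a b pos c
  up-crossing {b = zero} z≤n ha≤c c<hb = ⊥-elim (ℤ.<-irrefl refl (ℤ.≤-<-trans ha≤c c<hb))
  up-crossing {a} {suc b} {c} a≤1+b ha≤c c<hb with ℕ.m≤n⇒m<n∨m≡n a≤1+b
  ... | inj₂ refl = ⊥-elim (ℤ.<-irrefl refl (ℤ.≤-<-trans ha≤c c<hb))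
  ... | inj₁ (s≤s a≤b) with c ℤ.<? height b
  ...   | yes c<hb′ with k , a≤k , k<b , σk , lk ← up-crossing a≤b ha≤c c<hb′ =
          k , a≤k , ℕ.m≤n⇒m≤1+n k<b , σk , lk
  ...   | no  c≮hb′ with sign-cases (σ b)
  ...     | inj₁ up = b , a≤b , ℕ.≤-refl , up ,
            trans (sym (up-start up)) (sym (squeeze (subst (c ℤ.<_) (height-up up) c<hb) (ℤ.≮⇒≥ c≮hb′)))
  ...     | inj₂ down = ⊥-elim (c≮hb′ (ℤ.<-≤-trans (subst (c ℤ.<_) (height-down down) c<hb)
                                                   (ℤ.<⇒≤ (pred[i]<i (height b)))))

  down-crossing : ∀ {a b c} → a ≤ b → c ℤ.< height a → height b ℤ.≤ c → Crossing a b neg c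
  down-crossing {b = zero} z≤n c<ha hb≤c = ⊥-elim (ℤ.<-irrefl refl (ℤ.<-≤-trans c<ha hb≤c))
  down-crossing {a} {suc b} {c} a≤1+b c<ha hb≤c with ℕ.m≤n⇒m<n∨m≡n a≤1+b
  ... | inj₂ refl = ⊥-elim (ℤ.<-irrefl refl (ℤ.<-≤-trans c<ha hb≤c))
  ... | inj₁ (s≤s a≤b) with height b ℤ.≤? c
  ...   | yes hb′≤c with k , a≤k , k<b , σk , lk ← down-crossing a≤b c<ha hb′≤c =
          k , a≤k , ℕ.m≤n⇒m≤1+n k<b , σk , lk
  ...   | no  hb′≰c with sign-cases (σ b)
  ...     | inj₂ down = b , a≤b , ℕ.≤-refl , down ,
            ℤ.≤-antisym (subst (ℤ._≤ c) (down-end down) hb≤c)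
                        (subst (c ℤ.≤_) (trans (cong ℤ.pred (down-start down)) (ℤ.pred-suc _))
                               (ℤ.i<j⇒i≤pred[j] (ℤ.≰⇒> hb′≰c)))
  ...     | inj₁ up = ⊥-elim (hb′≰c (ℤ.<⇒≤ (ℤ.<-≤-trans (i<suc[i] (height b))
                                                    (subst (ℤ._≤ c) (height-up up) hb≤c))))

  parity-height : ∀ k → parity (height k) ≡ minusOnePow k
  parity-height zero    = refl
  parity-height (suc k) with sign-cases (σ k)
  ... | inj₁ up   = trans (cong parity (height-up up))
                          (trans (parity-suc (height k)) (cong opposite (parity-height k)))
  ... | inj₂ down = trans (cong parity (height-down down))
                          (trans (parity-pred (height k)) (cong opposite (parity-height k)))

  parity-level : ∀ k → parity (level k) ≡ σ k * minusOnePow k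
  parity-level k with sign-cases (σ k)
  ... | inj₁ up = begin
    parity (level k)       ≡⟨ cong parity (up-start up) ⟨
    parity (height k)      ≡⟨ parity-height k ⟩
    minusOnePow k          ≡⟨ cong (_* minusOnePow k) up ⟨
    σ k * minusOnePow k    ∎
    where open ≡-Reasoning
  ... | inj₂ down = begin
    parity (level k)                    ≡⟨ cong parity (down-end down) ⟨
    parity (height (suc k))             ≡⟨ parity-height (suc k) ⟩
    neg * minusOnePow k                 ≡⟨ cong (_* minusOnePow k) down ⟨
    σ k * minusOnePow k                 ∎
    where open ≡-Reasoning

  towards : Sign → ℤ → Bool
  towards pos z = does (z ℤ.<? 0ℤ)
  towards neg z = not (does (z ℤ.<? 0ℤ))

  towards-opposite : ∀ s z → towards (opposite s) z ≡ not (towards s z)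
  towards-opposite pos z = refl
  towards-opposite neg z = sym (Bool.not-involutive _)

  towardZero : ℕ → Bool
  towardZero k = towards (σ k) (level k)

  towardZero? : Decidable (T ∘ towardZero)
  towardZero? k = T? (towardZero k)

  towardZero-up : ∀ {k} → σ k ≡ pos → T (towardZero k) ⇔ ups k < downs k
  towardZero-up {k} up rewrite up = ⇔.trans (does⇔ (height k ℤ.<? 0ℤ)) m⊖n<0⇔m<n

  towardZero-down : ∀ {k} → σ k ≡ neg → T (towardZero k) ⇔ downs k < ups k
  towardZero-down {k} down rewrite down | ℤ.distribʳ-⊖-+-neg 0 (ups k) (downs k) =
    ⇔.trans (not-does⇔ (ups k ⊖ suc (downs k) ℤ.<? 0ℤ))
            (mk⇔ (λ ≮ → ℕ.≮⇒≥ (≮ ∘ Equivalence.from m⊖n<0⇔m<n))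
                 (λ d<u → ℕ.<⇒≱ d<u ∘ ℕ.≤-pred ∘ Equivalence.to m⊖n<0⇔m<n))

  count-towardZero : ∀ m → count towardZero? m ≡ ups m ⊓ downs m
  count-towardZero zero    = refl
  count-towardZero (suc m) with sign-cases (σ m)
  ... | inj₁ up = begin
    count towardZero? (suc m)    ≡⟨ Count.count-suc-⊓ towardZero? _ _ (towardZero-up up) (count-towardZero m) ⟩
    suc (ups m) ⊓ downs m        ≡⟨ cong₂ _⊓_ (Count.count-accept up? up)
                                              (Count.count-reject down? (≡opposite⇒≢ up)) ⟨
    ups (suc m) ⊓ downs (suc m)  ∎
    where open ≡-Reasoning
  ... | inj₂ down = begin
    count towardZero? (suc m)    ≡⟨ Count.count-suc-⊓ towardZero? _ _ (towardZero-down down)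
                                      (trans (count-towardZero m) (ℕ.⊓-comm (ups m) (downs m))) ⟩
    suc (downs m) ⊓ ups m        ≡⟨ ℕ.⊓-comm (suc (downs m)) (ups m) ⟩
    ups m ⊓ suc (downs m)        ≡⟨ cong₂ _⊓_ (Count.count-reject up? (≡opposite⇒≢ down))
                                              (Count.count-accept down? down) ⟨
    ups (suc m) ⊓ downs (suc m)  ∎
    where open ≡-Reasoning

  module AtLevel (t : ℤ) = BoundedSearch (λ k → level k ℤ.≟ t)

  Gap : ℤ → ℕ → ℕ → Set
  Gap = AtLevel.NoneBetween

  -- Opaque so that y can be inferred from prev y and next y; the lemmas in this block are all that
  -- is used of the definitions.
  opaque
    prev : ℕ → Maybe ℕ
    prev y = AtLevel.lastBelow (level y) y

    next : ℕ → Maybe ℕ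
    next y = AtLevel.firstAbove (level y) y (n ∸ y)

    prev-just : ∀ {y u} → prev y ≡ just u → u < y × level u ≡ level y × Gap (level y) u y
    prev-just = AtLevel.lastBelow-just _

    prev-exists : ∀ {y k} → k < y → level k ≡ level y → ∃[ u ] prev y ≡ just u × k ≤ u
    prev-exists = AtLevel.lastBelow-exists _

    next-just : ∀ {y v} → next y ≡ just v → y < v × v ≤ n × level v ≡ level y × Gap (level y) y v
    next-just e with y<v , v≤ , lv , gap ← AtLevel.firstAbove-just _ e = y<v , <-≤-bounded y<v v≤ , lv , gap

    next-exists : ∀ {y k} → y < k → k ≤ n → level k ≡ level y → ∃[ v ] next y ≡ just v × v ≤ k
    next-exists y<k k≤n = AtLevel.firstAbove-exists _ y<k (≤-+∸ (ℕ.<⇒≤ y<k) k≤n)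

    prev⇒next : ∀ {y u} → y ≤ n → prev y ≡ just u → next u ≡ just y
    prev⇒next y≤n e with u<y , lu , gap ← prev-just e =
      AtLevel.firstAbove-unique _ u<y (≤-+∸ (ℕ.<⇒≤ u<y) y≤n) (sym lu) (subst (λ t → Gap t _ _) (sym lu) gap)

    next⇒prev : ∀ {y v} → next y ≡ just v → prev v ≡ just y
    next⇒prev e with y<v , _ , lv , gap ← next-just e =
      AtLevel.lastBelow-unique _ y<v (sym lv) (subst (λ t → Gap t _ _) (sym lv) gap)

  alternate : ∀ {u v} → u < v → level u ≡ level v → Gap (level v) u v → σ u ≡ opposite (σ v)
  alternate {u} {v} u<v lu≡lv gap with sign-cases (σ u) | sign-cases (σ v)
  ... | inj₁ up | inj₂ down = trans up (cong opposite (sym down))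
  ... | inj₂ down | inj₁ up = trans down (cong opposite (sym up))
  ... | inj₁ up-u | inj₁ up-v
    with k , u<k , k<v , _ , lk ← down-crossing u<v
           (subst (ℤ._< height (suc u)) lu≡lv (level<up-end up-u))
           (ℤ.≤-reflexive (up-start up-v))
    = ⊥-elim (gap k u<k k<v lk)
  ... | inj₂ down-u | inj₂ down-v
    with k , u<k , k<v , _ , lk ← up-crossing u<v
           (ℤ.≤-reflexive (trans (down-end down-u) lu≡lv))
           (level<down-start down-v)
    = ⊥-elim (gap k u<k k<v lk)

  prev-opposite : ∀ {y u} → prev y ≡ just u → σ u ≡ opposite (σ y)
  prev-opposite e with u<y , lu , gap ← prev-just e = alternate u<y lu gap

  next-opposite : ∀ {y v} → next y ≡ just v → σ v ≡ opposite (σ y)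
  next-opposite e with y<v , _ , lv , gap ← next-just e =
    ≡opposite-sym (alternate y<v (sym lv) (subst (λ t → Gap t _ _) (sym lv) gap))

  towardZero-flip : ∀ {a u} → level a ≡ level u → σ a ≡ opposite (σ u) → towardZero a ≡ not (towardZero u)
  towardZero-flip {a} {u} la sa = trans (cong₂ towards sa la) (towards-opposite (σ u) (level u))

  towardZero-flip-true : ∀ {a u} → level a ≡ level u → σ a ≡ opposite (σ u) →
                         T (towardZero u) → towardZero a ≡ false
  towardZero-flip-true la sa t = trans (towardZero-flip la sa) (cong not (Equivalence.to Bool.T-≡ t))

  towardZero-flip-false : ∀ {a u} → level a ≡ level u → σ a ≡ opposite (σ u) →
                          towardZero u ≡ false → T (towardZero a)
  towardZero-flip-false la sa e = subst T (sym (trans (towardZero-flip la sa) (cong not e))) tt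

  towardZero⇒prev : ∀ {y} → T (towardZero y) → ∃[ u ] prev y ≡ just u
  towardZero⇒prev {y} t with sign-cases (σ y)
  ... | inj₁ up
    with k , _ , k<y , _ , lk ← down-crossing z≤n
           (Equivalence.to (does⇔ (level y ℤ.<? 0ℤ)) (subst (λ s → T (towards s (level y))) up t))
           (ℤ.≤-reflexive (up-start up))
    = let u , e , _ = prev-exists k<y lk in u , e
  ... | inj₂ down
    with k , _ , k<y , _ , lk ← up-crossing z≤n
           (ℤ.≮⇒≥ (Equivalence.to (not-does⇔ (level y ℤ.<? 0ℤ)) (subst (λ s → T (towards s (level y))) down t)))
           (level<down-start down)
    = let u , e , _ = prev-exists k<y lk in u , e

  Ahead : Sign → ℤ → ℤ → Set
  Ahead pos z w = z ℤ.< w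
  Ahead neg z w = w ℤ.< z

  Beyond : Sign → ℤ → ℤ → Bool → Set
  Beyond s z w e = Ahead s z w ⊎ (z ≡ w × T e)

  beyond? : ∀ s z w e → Dec (Beyond s z w e)
  beyond? pos z w e = (z ℤ.<? w) ⊎-dec ((z ℤ.≟ w) ×-dec T? e)
  beyond? neg z w e = (w ℤ.<? z) ⊎-dec ((z ℤ.≟ w) ×-dec T? e)

  Beyond-cong : ∀ {s s′ z z′ w w′ e e′} → s ≡ s′ → z ≡ z′ → w ≡ w′ → e ≡ e′ →
                Beyond s z w e → Beyond s′ z′ w′ e′
  Beyond-cong refl refl refl refl beyond = beyond

  Ahead⇒Beyond : ∀ {s s′ z w e} → s′ ≡ s → Ahead s z w → Beyond s′ z w e
  Ahead⇒Beyond refl ahead = inj₁ ahead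

  Ahead-irrefl : ∀ s {z} → ¬ Ahead s z z
  Ahead-irrefl pos = ℤ.<-irrefl refl
  Ahead-irrefl neg = ℤ.<-irrefl refl

  Ahead-opposite : ∀ s {z w} → Ahead s z w → ¬ Ahead (opposite s) z w
  Ahead-opposite pos = ℤ.<-asym
  Ahead-opposite neg = ℤ.<-asym

  Beyond-opposite : ∀ s {z w e} → Beyond s z w e → ¬ Beyond (opposite s) z w (not e)
  Beyond-opposite s (inj₁ ahead) (inj₁ ahead′)      = Ahead-opposite s ahead ahead′
  Beyond-opposite s (inj₁ ahead) (inj₂ (refl , _))  = Ahead-irrefl s ahead
  Beyond-opposite s (inj₂ (refl , _)) (inj₁ ahead′) = Ahead-irrefl (opposite s) ahead′
  Beyond-opposite s {e = true} (inj₂ (_ , _)) (inj₂ (_ , ()))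

  Beyond-tie : ∀ s {z e} → Beyond s z z e → T e
  Beyond-tie s (inj₁ ahead)     = ⊥-elim (Ahead-irrefl s ahead)
  Beyond-tie s (inj₂ (_ , t))   = t

  record Inner (u v : ℕ) : Set where
    constructor inner
    field
      u<v       : u < v
      v≤n       : v ≤ n
      direction : σ u ≡ σ v
      parity≡   : parity (level u) ≡ parity (level v)
      beyond    : Beyond (σ u) (level u) (level v) (towardZero u)

  inner? : ∀ u v → Dec (Inner u v)
  inner? u v = map′ (λ (a , b , c , d , e) → inner a b c d e)
                    (λ (inner a b c d e) → a , b , c , d , e)
                    ((u <? v) ×-dec (v ≤? n) ×-dec (σ u Sign.≟ σ v)
                      ×-dec (parity (level u) Sign.≟ parity (level v))
                      ×-dec beyond? (σ u) (level u) (level v) (towardZero u))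

  Inner-irrefl : ∀ {u} → ¬ Inner u u
  Inner-irrefl (inner u<u _ _ _ _) = ℕ.<-irrefl refl u<u

  Inner-exclusive : ∀ {u v a c} → Inner u v → σ a ≡ opposite (σ u) → level a ≡ level u → level c ≡ level v →
                    ¬ Inner a c
  Inner-exclusive {u} (inner _ _ _ _ beyond-uv) σa la lc (inner _ _ _ _ beyond-ac) =
    Beyond-opposite (σ u) beyond-uv (Beyond-cong σa la lc (towardZero-flip la σa) beyond-ac)

  data Key : Set where
    rect : ℕ → ℕ → Key
    hook : ℕ → Key

  Valid : Key → Set
  Valid (rect u v) = Inner u v
  Valid (hook y)   = y ≤ n × T (towardZero y)

  -- The pair (i, j) involves the steps i − 1 and j, hence the suc.
  rectBlock : ℕ → ℕ → Maybe ℕ → Maybe ℕ → Block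
  rectBlock u v nothing  nothing  = f1 , (suc u , v) ∷ []
  rectBlock u v (just a) nothing  = f2 , (suc u , v) ∷ (suc a , v) ∷ []
  rectBlock u v nothing  (just b) = f2 , (suc u , v) ∷ (suc u , b) ∷ []
  rectBlock u v (just a) (just b) = f3 , (suc u , v) ∷ (suc a , v) ∷ (suc u , b) ∷ (suc a , b) ∷ []

  hookBlock : ℕ → Maybe ℕ → Maybe ℕ → Block
  hookBlock y nothing  _        = f4 , []   -- unreachable: see towardZero⇒prev
  hookBlock y (just w) nothing  = f4 , (suc w , y) ∷ []
  hookBlock y (just w) (just z) = f5 , (suc w , z) ∷ (suc y , z) ∷ (suc w , y) ∷ []

  blockOf : Key → Block
  blockOf (rect u v) = rectBlock u v (prev u) (next v)
  blockOf (hook y)   = hookBlock y (prev y) (next y)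

  tryRect : Maybe ℕ → Maybe ℕ → Maybe Key
  tryRect (just u) (just v) with inner? u v
  ... | yes _ = just (rect u v)
  ... | no  _ = nothing
  tryRect _ _ = nothing

  outerKey : Maybe ℕ → Maybe ℕ → Key
  outerKey (just u) (just v) with u <? v
  ... | yes _ = rect u v
  ... | no  _ = hook u
  outerKey _ _ = hook 0   -- junk, not reached from a canonical pair

  hookChoice : ℕ → ℕ → Key
  hookChoice a b = if towardZero b then hook b else hook a

  -- Equal directions: (a, b) is the inner pair of its rectangle, or the far corner of the block
  -- spanned by next a and prev b. Opposite directions: (a, b) is a side of the rectangle spanned by
  -- (a, prev b) or by (next a, b), or else a side of a hook.
  sameKey : ℕ → ℕ → Key
  sameKey a b = fromMaybe (outerKey (next a) (prev b)) (tryRect (just a) (just b))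

  oppositeKey : ℕ → ℕ → Key
  oppositeKey a b = fromMaybe (hookChoice a b)
                              (tryRect (just a) (prev b) <∣> tryRect (next a) (just b))

  keyBy : ∀ a b → Dec (σ a ≡ σ b) → Key
  keyBy a b (yes _) = sameKey a b
  keyBy a b (no  _) = oppositeKey a b

  keyOf : ℕ → ℕ → Key
  keyOf a b = keyBy a b (σ a Sign.≟ σ b)

  NoRect : Maybe ℕ → Maybe ℕ → Set
  NoRect mu mv = ∀ {u v} → mu ≡ just u → mv ≡ just v → ¬ Inner u v

  tryRect-yes : ∀ {mu mv u v} → mu ≡ just u → mv ≡ just v → Inner u v → tryRect mu mv ≡ just (rect u v)
  tryRect-yes {u = u} {v} refl refl i with inner? u v
  ... | yes _ = refl
  ... | no ¬i = ⊥-elim (¬i i)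

  tryRect-no : ∀ {mu mv} → NoRect mu mv → tryRect mu mv ≡ nothing
  tryRect-no {just u} {just v} none with inner? u v
  ... | yes i = ⊥-elim (none refl refl i)
  ... | no  _ = refl
  tryRect-no {just _} {nothing} _ = refl
  tryRect-no {nothing}          _ = refl

  keyOf-same : ∀ {a b} → σ a ≡ σ b → keyOf a b ≡ sameKey a b
  keyOf-same {a} {b} same = cong (keyBy a b) (proj₂ (dec-yes (σ a Sign.≟ σ b) same))

  keyOf-opposite : ∀ {a b} → σ a ≢ σ b → keyOf a b ≡ oppositeKey a b
  keyOf-opposite {a} {b} a≢b = cong (keyBy a b) (dec-no (σ a Sign.≟ σ b) a≢b)

  keyOf-inner : ∀ {u v} → Inner u v → keyOf u v ≡ rect u v
  keyOf-inner {u} {v} i =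
    trans (keyOf-same (Inner.direction i))
          (cong (fromMaybe (outerKey (next u) (prev v))) (tryRect-yes refl refl i))

  keyOf-outer : ∀ {a b} → σ a ≡ σ b → ¬ Inner a b → keyOf a b ≡ outerKey (next a) (prev b)
  keyOf-outer {a} {b} same ¬i =
    trans (keyOf-same same)
          (cong (fromMaybe (outerKey (next a) (prev b))) (tryRect-no {just a} {just b} λ { refl refl → ¬i }))

  outerKey-rect : ∀ {u v} → u < v → outerKey (just u) (just v) ≡ rect u v
  outerKey-rect {u} {v} u<v with u <? v
  ... | yes _ = refl
  ... | no u≮v = ⊥-elim (u≮v u<v)

  outerKey-hook : ∀ {y} → outerKey (just y) (just y) ≡ hook y
  outerKey-hook {y} with y <? y
  ... | yes y<y = ⊥-elim (ℕ.<-irrefl refl y<y)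
  ... | no  _   = refl

  keyOf-tests : ∀ {a b m₁ m₂} → σ a ≢ σ b → tryRect (just a) (prev b) ≡ m₁ → tryRect (next a) (just b) ≡ m₂ →
                keyOf a b ≡ fromMaybe (hookChoice a b) (m₁ <∣> m₂)
  keyOf-tests {a} {b} a≢b e₁ e₂ =
    trans (keyOf-opposite a≢b) (cong₂ (λ m m′ → fromMaybe (hookChoice a b) (m <∣> m′)) e₁ e₂)

  keyOf-rect-right : ∀ {a b c} → σ a ≢ σ b → prev b ≡ just c → Inner a c → keyOf a b ≡ rect a c
  keyOf-rect-right a≢b e i = keyOf-tests a≢b (tryRect-yes refl e i) refl

  keyOf-rect-left : ∀ {a b d} → σ a ≢ σ b → NoRect (just a) (prev b) → next a ≡ just d → Inner d b →
                    keyOf a b ≡ rect d b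
  keyOf-rect-left a≢b none e i = keyOf-tests a≢b (tryRect-no none) (tryRect-yes e refl i)

  keyOf-hook : ∀ {a b} → σ a ≢ σ b → NoRect (just a) (prev b) → NoRect (next a) (just b) →
               keyOf a b ≡ hookChoice a b
  keyOf-hook a≢b none₁ none₂ = keyOf-tests a≢b (tryRect-no none₁) (tryRect-no none₂)

  prev-< : ∀ {y u} → prev y ≡ just u → u < y
  prev-< = proj₁ ∘ prev-just

  prev-level : ∀ {y u} → prev y ≡ just u → level u ≡ level y
  prev-level = proj₁ ∘ proj₂ ∘ prev-just

  next-< : ∀ {y v} → next y ≡ just v → y < v
  next-< = proj₁ ∘ next-just

  next-≤ : ∀ {y v} → next y ≡ just v → v ≤ n
  next-≤ = proj₁ ∘ proj₂ ∘ next-just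

  next-level : ∀ {y v} → next y ≡ just v → level v ≡ level y
  next-level = proj₁ ∘ proj₂ ∘ proj₂ ∘ next-just

  Canonical : Pair → Set
  Canonical (zero  , _) = ⊥
  Canonical (suc a , b) = a < b × b ≤ n × parity (level a) ≡ parity (level b)

  pairKey : Pair → Key
  pairKey (i , j) = keyOf (ℕ.pred i) j

  Owned : Key → Pair → Set
  Owned k p = Canonical p × pairKey p ≡ k

  canonical-via : ∀ {a b u v} → a < b → b ≤ n → level a ≡ level u → level b ≡ level v →
                  parity (level u) ≡ parity (level v) → Canonical (suc a , b)
  canonical-via a<b b≤n la lb p≡ = a<b , b≤n , trans (cong parity la) (trans p≡ (cong parity (sym lb)))

  NoRect-diagonal : ∀ {mu mv y} → mu ≡ just y → mv ≡ just y → NoRect mu mv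
  NoRect-diagonal e₁ e₂ e₁′ e₂′ i =
    Inner-irrefl (subst₂ Inner (just-injective (trans (sym e₁′) e₁)) (just-injective (trans (sym e₂′) e₂)) i)

  module _ {u v} (i : Inner u v) where
    open Inner i

    private
      u≤n : u ≤ n
      u≤n = ℕ.<⇒≤ (ℕ.<-≤-trans u<v v≤n)

    rect-corner : Owned (rect u v) (suc u , v)
    rect-corner = canonical-via u<v v≤n refl refl parity≡ , keyOf-inner i

    rect-left : ∀ {a} → prev u ≡ just a → Owned (rect u v) (suc a , v)
    rect-left {a} ea =
      canonical-via (ℕ.<-trans (prev-< ea) u<v) v≤n (prev-level ea) refl parity≡ ,
      keyOf-rect-left (≡opposite⇒≢ σa) noRect (prev⇒next u≤n ea) i
      where
      σa : σ a ≡ opposite (σ v)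
      σa = trans (prev-opposite ea) (cong opposite direction)
      noRect : NoRect (just a) (prev v)
      noRect refl ec = Inner-exclusive i (prev-opposite ea) (prev-level ea) (prev-level ec)

    rect-right : ∀ {b} → next v ≡ just b → Owned (rect u v) (suc u , b)
    rect-right eb =
      canonical-via (ℕ.<-trans u<v (next-< eb)) (next-≤ eb) refl (next-level eb) parity≡ ,
      keyOf-rect-right (≡opposite⇒≢ σu) (next⇒prev eb) i
      where
      σu : σ u ≡ opposite (σ _)
      σu = trans direction (≡opposite-sym (next-opposite eb))

    rect-far : ∀ {a b} → prev u ≡ just a → next v ≡ just b → Owned (rect u v) (suc a , b)
    rect-far ea eb =
      canonical-via (ℕ.<-trans (prev-< ea) (ℕ.<-trans u<v (next-< eb))) (next-≤ eb)
                    (prev-level ea) (next-level eb) parity≡ ,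
      (begin
        keyOf _ _                       ≡⟨ keyOf-outer σa≡σb
                                             (Inner-exclusive i (prev-opposite ea) (prev-level ea) (next-level eb)) ⟩
        outerKey (next _) (prev _)      ≡⟨ cong₂ outerKey (prev⇒next u≤n ea) (next⇒prev eb) ⟩
        outerKey (just u) (just v)      ≡⟨ outerKey-rect u<v ⟩
        rect u v                        ∎)
      where
      open ≡-Reasoning
      σa≡σb : σ _ ≡ σ _
      σa≡σb = trans (prev-opposite ea) (trans (cong opposite direction) (sym (next-opposite eb)))

  module _ {y} (y≤n : y ≤ n) (toward : T (towardZero y)) where

    hook-left : ∀ {w} → prev y ≡ just w → Owned (hook y) (suc w , y)
    hook-left {w} ew =
      canonical-via (prev-< ew) y≤n (prev-level ew) refl refl ,
      trans (keyOf-hook (≡opposite⇒≢ (prev-opposite ew)) (NoRect-diagonal refl ew)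
                        (NoRect-diagonal (prev⇒next y≤n ew) refl))
            (cong (if_then hook y else hook w) (Equivalence.to Bool.T-≡ toward))

    hook-right : ∀ {z} → next y ≡ just z → Owned (hook y) (suc y , z)
    hook-right {z} ez =
      canonical-via (next-< ez) (next-≤ ez) refl (next-level ez) refl ,
      trans (keyOf-hook (≡opposite⇒≢ (≡opposite-sym (next-opposite ez))) (NoRect-diagonal refl (next⇒prev ez))
                        (NoRect-diagonal ez refl))
            (cong (if_then hook z else hook y) (towardZero-flip-true (next-level ez) (next-opposite ez) toward))

    hook-far : ∀ {w z} → prev y ≡ just w → next y ≡ just z → Owned (hook y) (suc w , z)
    hook-far {w} {z} ew ez =
      canonical-via (ℕ.<-trans (prev-< ew) (next-< ez)) (next-≤ ez) (prev-level ew) (next-level ez) refl ,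
      (begin
        keyOf w z                    ≡⟨ keyOf-outer σw≡σz ¬inner ⟩
        outerKey (next w) (prev z)   ≡⟨ cong₂ outerKey (prev⇒next y≤n ew) (next⇒prev ez) ⟩
        outerKey (just y) (just y)   ≡⟨ outerKey-hook ⟩
        hook y                       ∎)
      where
      open ≡-Reasoning
      σw≡σz : σ w ≡ σ z
      σw≡σz = trans (prev-opposite ew) (sym (next-opposite ez))
      ¬inner : ¬ Inner w z
      ¬inner (inner _ _ _ _ beyond) =
        subst T (towardZero-flip-true (prev-level ew) (prev-opposite ew) toward)
          (Beyond-tie (σ w) (Beyond-cong refl refl (trans (next-level ez) (sym (prev-level ew))) refl beyond))

  blockOf-owned : ∀ {k p} → Valid k → p ∈ proj₂ (blockOf k) → Owned k p
  blockOf-owned {rect u v} i p∈ with prev u in ea | next v in eb | p∈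
  ... | nothing | nothing | here refl                         = rect-corner i
  ... | just _  | nothing | here refl                         = rect-corner i
  ... | just _  | nothing | there (here refl)                 = rect-left i ea
  ... | nothing | just _  | here refl                         = rect-corner i
  ... | nothing | just _  | there (here refl)                 = rect-right i eb
  ... | just _  | just _  | here refl                         = rect-corner i
  ... | just _  | just _  | there (here refl)                 = rect-left i ea
  ... | just _  | just _  | there (there (here refl))         = rect-right i eb
  ... | just _  | just _  | there (there (there (here refl))) = rect-far i ea eb
  blockOf-owned {hook y} (y≤n , t) p∈ with prev y in ew | next y in ez | p∈
  ... | just _ | nothing | here refl                 = hook-left y≤n t ew
  ... | just _ | just _  | here refl                 = hook-far y≤n t ew ez
  ... | just _ | just _  | there (here refl)         = hook-right y≤n t ez
  ... | just _ | just _  | there (there (here refl)) = hook-left y≤n t ew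

  blockOf-unique : ∀ k → Unique (proj₂ (blockOf k))
  blockOf-unique (rect u v) with prev u in ea | next v in eb
  ... | nothing | nothing = [] ∷ []
  ... | just a  | nothing = (≢-fst (suc-≢ (prev-< ea) ∘ sym) ∷ []) ∷ [] ∷ []
  ... | nothing | just b  = (≢-snd (ℕ.<⇒≢ (next-< eb)) ∷ []) ∷ [] ∷ []
  ... | just a  | just b  =
    (a≢u ∷ ≢-snd (ℕ.<⇒≢ (next-< eb)) ∷ a≢u ∷ []) ∷
    (≢-fst (suc-≢ (prev-< ea)) ∷ ≢-snd (ℕ.<⇒≢ (next-< eb)) ∷ []) ∷
    (a≢u ∷ []) ∷ [] ∷ []
    where
    a≢u : ∀ {j j′} → (suc _ , j) ≢ (suc a , j′)
    a≢u = ≢-fst (suc-≢ (prev-< ea) ∘ sym)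
  blockOf-unique (hook y) with prev y in ew | next y in ez
  ... | nothing | _       = []
  ... | just w  | nothing = [] ∷ []
  ... | just w  | just z  =
    (≢-fst (suc-≢ (prev-< ew)) ∷ ≢-snd (ℕ.<⇒≢ (next-< ez) ∘ sym) ∷ []) ∷
    (≢-fst (suc-≢ (prev-< ew) ∘ sym) ∷ []) ∷ [] ∷ []

  ∈-rect-corner : ∀ {u v} → (suc u , v) ∈ proj₂ (blockOf (rect u v))
  ∈-rect-corner {u} {v} with prev u | next v
  ... | nothing | nothing = here refl
  ... | just _  | nothing = here refl
  ... | nothing | just _  = here refl
  ... | just _  | just _  = here refl

  ∈-rect-left : ∀ {u v a} → prev u ≡ just a → (suc a , v) ∈ proj₂ (blockOf (rect u v))
  ∈-rect-left {u} {v} ea rewrite ea with next v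
  ... | nothing = there (here refl)
  ... | just _  = there (here refl)

  ∈-rect-right : ∀ {u v b} → next v ≡ just b → (suc u , b) ∈ proj₂ (blockOf (rect u v))
  ∈-rect-right {u} {v} eb rewrite eb with prev u
  ... | nothing = there (here refl)
  ... | just _  = there (there (here refl))

  ∈-rect-far : ∀ {u v a b} → prev u ≡ just a → next v ≡ just b → (suc a , b) ∈ proj₂ (blockOf (rect u v))
  ∈-rect-far ea eb rewrite ea | eb = there (there (there (here refl)))

  ∈-hook-left : ∀ {y w} → prev y ≡ just w → (suc w , y) ∈ proj₂ (blockOf (hook y))
  ∈-hook-left {y} ew rewrite ew with next y
  ... | nothing = here refl
  ... | just _  = there (there (here refl))

  ∈-hook-right : ∀ {y w z} → prev y ≡ just w → next y ≡ just z → (suc y , z) ∈ proj₂ (blockOf (hook y))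
  ∈-hook-right ew ez rewrite ew | ez = there (here refl)

  ∈-hook-far : ∀ {y w z} → prev y ≡ just w → next y ≡ just z → (suc w , z) ∈ proj₂ (blockOf (hook y))
  ∈-hook-far ew ez rewrite ew | ez = here refl

  Located : ℕ → ℕ → Set
  Located a b = ∃[ k ] Valid k × (suc a , b) ∈ proj₂ (blockOf k)

  next-minimal : ∀ {a a′ k} → next a ≡ just a′ → a < k → k ≤ n → level k ≡ level a → a′ ≤ k
  next-minimal ea a<k k≤n lk with _ , ea′ , v≤k ← next-exists a<k k≤n lk =
    subst (_≤ _) (just-injective (trans (sym ea′) ea)) v≤k

  located-outer-rect : ∀ {a b a′ b′} → b ≤ n → next a ≡ just a′ → prev b ≡ just b′ → Inner a′ b′ → Located a b
  located-outer-rect b≤n ea eb i = rect _ _ , i , ∈-rect-far (next⇒prev ea) (prev⇒next b≤n eb)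

  located-outer-hook : ∀ {a b y} → b ≤ n → next a ≡ just y → prev b ≡ just y → T (towardZero y) → Located a b
  located-outer-hook b≤n ea eb t = hook _ , (next-≤ ea , t) , ∈-hook-far (next⇒prev ea) (prev⇒next b≤n eb)

  rect-or-none : ∀ mu mv → NoRect mu mv ⊎ ∃[ u ] ∃[ v ] mu ≡ just u × mv ≡ just v × Inner u v
  rect-or-none (just u) (just v) with inner? u v
  ... | yes i = inj₂ (u , v , refl , refl , i)
  ... | no ¬i = inj₁ λ { refl refl → ¬i }
  rect-or-none (just _) nothing = inj₁ λ _ ()
  rect-or-none nothing  _       = inj₁ λ ()

  rect-with-prev : ∀ {a b k} → a < k → k < b → b ≤ n → level k ≡ level b →
              parity (level a) ≡ parity (level b) → σ a ≡ opposite (σ b) →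
              Beyond (σ a) (level a) (level b) (towardZero a) → ¬ NoRect (just a) (prev b)
  rect-with-prev a<k k<b b≤n lk par σab beyond none with c , ec , k≤c ← prev-exists k<b lk =
    none refl ec (inner (ℕ.<-≤-trans a<k k≤c) (ℕ.≤-trans (ℕ.<⇒≤ (prev-< ec)) b≤n)
                        (trans σab (sym (prev-opposite ec)))
                        (trans par (cong parity (sym (prev-level ec))))
                        (Beyond-cong refl refl (sym (prev-level ec)) refl beyond))

  rect-with-next : ∀ {a b k} → a < k → k < b → b ≤ n → level k ≡ level a →
              parity (level a) ≡ parity (level b) → σ a ≡ opposite (σ b) →
              Beyond (σ b) (level a) (level b) (not (towardZero a)) → ¬ NoRect (next a) (just b)
  rect-with-next a<k k<b b≤n lk par σab beyond none
    with d , ed , d≤k ← next-exists a<k (ℕ.≤-trans (ℕ.<⇒≤ k<b) b≤n) lk =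
    none ed refl (inner (ℕ.≤-<-trans d≤k k<b) b≤n σd≡σb (trans (cong parity (next-level ed)) par)
                        (Beyond-cong (sym σd≡σb) (sym (next-level ed)) refl
                                     (sym (towardZero-flip (next-level ed) (next-opposite ed))) beyond))
    where
    σd≡σb = trans (next-opposite ed) (sym (≡opposite-sym σab))

  adjacent : ∀ {a b} → a < b → b ≤ n → parity (level a) ≡ parity (level b) → σ a ≡ opposite (σ b) →
             NoRect (just a) (prev b) → NoRect (next a) (just b) → next a ≡ just b × level a ≡ level b
  adjacent {a} {b} a<b b≤n par σab none₁ none₂ with sign-cases (σ a) | ℤ.<-cmp (level a) (level b)
  ... | inj₁ up | tri< la<lb _ _
    with k , a<k , k<b , _ , lk ← up-crossing a<b
           (subst (ℤ._≤ level b) (sym (up-end up)) (ℤ.i<j⇒suc[i]≤j la<lb))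
           (level<down-start (≡opposite-sym′ σab up))
    = ⊥-elim (rect-with-prev a<k k<b b≤n lk par σab (Ahead⇒Beyond up la<lb) none₁)
  ... | inj₁ up | tri> _ _ lb<la
    with k , a<k , k<b , _ , lk ← down-crossing a<b
           (level<up-end up)
           (subst (ℤ._≤ level a) (sym (down-start (≡opposite-sym′ σab up))) (ℤ.i<j⇒suc[i]≤j lb<la))
    = ⊥-elim (rect-with-next a<k k<b b≤n lk par σab (Ahead⇒Beyond (≡opposite-sym′ σab up) lb<la) none₂)
  ... | inj₂ down | tri> _ _ lb<la
    with k , a<k , k<b , _ , lk ← down-crossing a<b
           (subst (level b ℤ.<_) (sym (down-end down)) lb<la)
           (ℤ.≤-reflexive (up-start (≡opposite-sym′ σab down)))
    = ⊥-elim (rect-with-prev a<k k<b b≤n lk par σab (Ahead⇒Beyond down lb<la) none₁)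
  ... | inj₂ down | tri< la<lb _ _
    with k , a<k , k<b , _ , lk ← up-crossing a<b
           (ℤ.≤-reflexive (down-end down))
           (subst (level a ℤ.<_) (sym (up-start (≡opposite-sym′ σab down))) la<lb)
    = ⊥-elim (rect-with-next a<k k<b b≤n lk par σab (Ahead⇒Beyond (≡opposite-sym′ σab down) la<lb) none₂)
  ... | _ | tri≈ _ la≡lb _
    with d , ed , d≤b ← next-exists a<b b≤n (sym la≡lb) | ℕ.m≤n⇒m<n∨m≡n d≤b
  ...   | inj₂ refl = ed , la≡lb
  ...   | inj₁ d<b with towardZero a in e
  ...     | true  = ⊥-elim (rect-with-prev (next-< ed) d<b b≤n (trans (next-level ed) la≡lb) par σab
                                      (inj₂ (la≡lb , subst T (sym e) tt)) none₁)
  ...     | false = ⊥-elim (rect-with-next (next-< ed) d<b b≤n (next-level ed) par σab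
                                      (inj₂ (la≡lb , subst (T ∘ not) (sym e) tt)) none₂)

  located-opposite : ∀ {a b} → a < b → b ≤ n → parity (level a) ≡ parity (level b) → σ a ≡ opposite (σ b) →
                     Located a b
  located-opposite {a} {b} a<b b≤n par σab with rect-or-none (just a) (prev b)
  ... | inj₂ (_ , c , refl , ec , i) = rect a c , i , ∈-rect-right (prev⇒next b≤n ec)
  ... | inj₁ none₁ with rect-or-none (next a) (just b)
  ...   | inj₂ (d , _ , ed , refl , i) = rect d b , i , ∈-rect-left (next⇒prev ed)
  ...   | inj₁ none₂ with eb , la≡lb ← adjacent a<b b≤n par σab none₁ none₂ | towardZero b in e
  ...     | true  = hook b , (b≤n , subst T (sym e) tt) , ∈-hook-left (next⇒prev eb)
  ...     | false = hook a , (ℕ.<⇒≤ (ℕ.<-≤-trans a<b b≤n) , toward-a) ,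
                    ∈-hook-right (proj₂ (towardZero⇒prev toward-a)) eb
    where
    toward-a : T (towardZero a)
    toward-a = towardZero-flip-false la≡lb σab e

  located-same-level : ∀ {a b} → a < b → b ≤ n → σ a ≡ σ b → level a ≡ level b → towardZero a ≡ false → Located a b
  located-same-level {a} {b} a<b b≤n σa≡σb la≡lb e
    with a′ , ea , _ ← next-exists a<b b≤n (sym la≡lb) | b′ , eb , a≤b′ ← prev-exists a<b la≡lb
    with ℕ.m≤n⇒m<n∨m≡n (next-minimal ea (ℕ.≤∧≢⇒< a≤b′ λ { refl → ≡opposite⇒≢ (prev-opposite eb) σa≡σb })
                                      (ℕ.≤-trans (ℕ.<⇒≤ (prev-< eb)) b≤n) (trans (prev-level eb) (sym la≡lb)))
  ... | inj₂ refl = located-outer-hook b≤n ea eb (towardZero-flip-false (next-level ea) (next-opposite ea) e)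
  ... | inj₁ a′<b′ = located-outer-rect b≤n ea eb
    (inner a′<b′ (ℕ.≤-trans (ℕ.<⇒≤ (prev-< eb)) b≤n)
           (trans (next-opposite ea) (trans (cong opposite σa≡σb) (sym (prev-opposite eb))))
           (cong parity la′≡lb′)
           (inj₂ (la′≡lb′ , towardZero-flip-false (next-level ea) (next-opposite ea) e)))
    where
    la′≡lb′ : level a′ ≡ level b′
    la′≡lb′ = trans (next-level ea) (trans la≡lb (sym (prev-level eb)))

  located-both-up : ∀ {a b} → a < b → b ≤ n → σ a ≡ pos → σ b ≡ pos → parity (level a) ≡ parity (level b) →
               level b ℤ.< level a → Located a b
  located-both-up {a} {b} a<b b≤n up-a up-b par lb<la
    with k₁ , a<k₁ , k₁<b , _ , lk₁ ← down-crossing a<b (level<up-end up-a)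
                                        (subst (ℤ._≤ level a) (sym (up-start up-b)) (ℤ.<⇒≤ lb<la))
       | k₂ , a<k₂ , k₂<b , _ , lk₂ ← down-crossing a<b (ℤ.<-trans lb<la (level<up-end up-a))
                                        (ℤ.≤-reflexive (up-start up-b))
    with a′ , ea , _ ← next-exists a<k₁ (ℕ.≤-trans (ℕ.<⇒≤ k₁<b) b≤n) lk₁ | b′ , eb , k₂≤b′ ← prev-exists k₂<b lk₂
    with k₃ , a<k₃ , k₃<b′ , _ , lk₃ ← down-crossing (ℕ.<-≤-trans a<k₂ k₂≤b′) (level<up-end up-a)
           (subst (ℤ._≤ level a) (sym (trans (down-start (trans (prev-opposite eb) (cong opposite up-b)))
                                              (cong ℤ.suc (prev-level eb))))
                  (ℤ.i<j⇒suc[i]≤j lb<la))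
    = located-outer-rect b≤n ea eb
        (inner (ℕ.≤-<-trans (next-minimal ea a<k₃ (ℕ.≤-trans (ℕ.<⇒≤ k₃<b′) b′≤n) lk₃) k₃<b′) b′≤n
               (trans σa′ (sym σb′))
               (trans (cong parity (next-level ea)) (trans par (cong parity (sym (prev-level eb)))))
               (Beyond-cong (sym σa′) (sym (next-level ea)) (sym (prev-level eb)) refl (inj₁ lb<la)))
    where
    b′≤n : b′ ≤ n
    b′≤n = ℕ.≤-trans (ℕ.<⇒≤ (prev-< eb)) b≤n
    σa′ : σ a′ ≡ neg
    σa′ = trans (next-opposite ea) (cong opposite up-a)
    σb′ : σ b′ ≡ neg
    σb′ = trans (prev-opposite eb) (cong opposite up-b)

  located-both-down : ∀ {a b} → a < b → b ≤ n → σ a ≡ neg → σ b ≡ neg → parity (level a) ≡ parity (level b) →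
                 level a ℤ.< level b → Located a b
  located-both-down {a} {b} a<b b≤n down-a down-b par la<lb
    with k₁ , a<k₁ , k₁<b , _ , lk₁ ← up-crossing a<b (ℤ.≤-reflexive (down-end down-a))
                                        (ℤ.<-trans la<lb (level<down-start down-b))
       | k₂ , a<k₂ , k₂<b , _ , lk₂ ← up-crossing a<b (subst (ℤ._≤ level b) (sym (down-end down-a)) (ℤ.<⇒≤ la<lb))
                                        (level<down-start down-b)
    with a′ , ea , _ ← next-exists a<k₁ (ℕ.≤-trans (ℕ.<⇒≤ k₁<b) b≤n) lk₁ | b′ , eb , k₂≤b′ ← prev-exists k₂<b lk₂
    with k₃ , a<k₃ , k₃<b′ , _ , lk₃ ← up-crossing (ℕ.<-≤-trans a<k₂ k₂≤b′) (ℤ.≤-reflexive (down-end down-a))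
           (subst (level a ℤ.<_)
                  (sym (trans (up-start (trans (prev-opposite eb) (cong opposite down-b))) (prev-level eb))) la<lb)
    = located-outer-rect b≤n ea eb
        (inner (ℕ.≤-<-trans (next-minimal ea a<k₃ (ℕ.≤-trans (ℕ.<⇒≤ k₃<b′) b′≤n) lk₃) k₃<b′) b′≤n
               (trans σa′ (sym σb′))
               (trans (cong parity (next-level ea)) (trans par (cong parity (sym (prev-level eb)))))
               (Beyond-cong (sym σa′) (sym (next-level ea)) (sym (prev-level eb)) refl (inj₁ la<lb)))
    where
    b′≤n : b′ ≤ n
    b′≤n = ℕ.≤-trans (ℕ.<⇒≤ (prev-< eb)) b≤n
    σa′ : σ a′ ≡ pos
    σa′ = trans (next-opposite ea) (cong opposite down-a)
    σb′ : σ b′ ≡ pos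
    σb′ = trans (prev-opposite eb) (cong opposite down-b)

  located-same : ∀ {a b} → a < b → b ≤ n → parity (level a) ≡ parity (level b) → σ a ≡ σ b → Located a b
  located-same {a} {b} a<b b≤n par σa≡σb with inner? a b
  ... | yes i = rect a b , i , ∈-rect-corner
  ... | no ¬i with sign-cases (σ a) | ℤ.<-cmp (level a) (level b)
  ...   | inj₁ up   | tri< la<lb _ _ = ⊥-elim (¬i (inner a<b b≤n σa≡σb par (Ahead⇒Beyond up la<lb)))
  ...   | inj₁ up   | tri> _ _ lb<la = located-both-up a<b b≤n up (trans (sym σa≡σb) up) par lb<la
  ...   | inj₂ down | tri> _ _ lb<la = ⊥-elim (¬i (inner a<b b≤n σa≡σb par (Ahead⇒Beyond down lb<la)))
  ...   | inj₂ down | tri< la<lb _ _ = located-both-down a<b b≤n down (trans (sym σa≡σb) down) par la<lb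
  ...   | _         | tri≈ _ la≡lb _ with towardZero a in e
  ...     | true  = ⊥-elim (¬i (inner a<b b≤n σa≡σb par (inj₂ (la≡lb , subst T (sym e) tt))))
  ...     | false = located-same-level a<b b≤n σa≡σb la≡lb e

  located : ∀ {a b} → a < b → b ≤ n → parity (level a) ≡ parity (level b) → Located a b
  located {a} {b} a<b b≤n par with σ a Sign.≟ σ b
  ... | yes σa≡σb = located-same a<b b≤n par σa≡σb
  ... | no  σa≢σb = located-opposite a<b b≤n par (≢⇒≡opposite σa≢σb)

  inner-pair? : Decidable (uncurry Inner)
  inner-pair? (u , v) = inner? u v

  pairs : List (ℕ × ℕ)
  pairs = cartesianProduct (upTo (suc n)) (upTo (suc n))

  hooks rects keys : List Key
  hooks = map hook (filter towardZero? (upTo (suc n)))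
  rects = map (uncurry rect) (filter inner-pair? pairs)
  keys  = hooks ++ rects

  keys-valid : ∀ {k} → k ∈ keys → Valid k
  keys-valid k∈ with ∈-++⁻ hooks k∈
  ... | inj₁ k∈hooks with y , y∈ , refl ← ∈-map⁻ hook k∈hooks =
    let y∈upTo , t = ∈-filter⁻ towardZero? y∈ in ℕ.≤-pred (∈-upTo⁻ y∈upTo) , t
  ... | inj₂ k∈rects with (u , v) , uv∈ , refl ← ∈-map⁻ (uncurry rect) k∈rects =
    proj₂ (∈-filter⁻ inner-pair? {xs = pairs} uv∈)

  valid⇒∈keys : ∀ {k} → Valid k → k ∈ keys
  valid⇒∈keys {hook y} (y≤n , t) = ∈-++⁺ˡ (∈-map⁺ hook (∈-filter⁺ towardZero? (∈-upTo⁺ (s≤s y≤n)) t))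
  valid⇒∈keys {rect u v} i = ∈-++⁺ʳ hooks (∈-map⁺ (uncurry rect) (∈-filter⁺ inner-pair?
    (∈-cartesianProduct⁺ (∈-upTo⁺ (s≤s (ℕ.<⇒≤ (ℕ.<-≤-trans (Inner.u<v i) (Inner.v≤n i)))))
                         (∈-upTo⁺ (s≤s (Inner.v≤n i))))
    i))

  keys-unique : Unique keys
  keys-unique = Unique.++⁺
    (Unique.map⁺ (λ { refl → refl }) (Unique.filter⁺ towardZero? {upTo (suc n)} (Unique.upTo⁺ (suc n))))
    (Unique.map⁺ (λ { refl → refl })
      (Unique.filter⁺ inner-pair? {pairs} (Unique.cartesianProduct⁺ (Unique.upTo⁺ (suc n)) (Unique.upTo⁺ (suc n)))))
    hook≢rect
    where
    hook≢rect : Disjoint hooks rects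
    hook≢rect (k∈hooks , k∈rects) with _ , _ , refl ← ∈-map⁻ hook k∈hooks
      with _ , _ , () ← ∈-map⁻ (uncurry rect) k∈rects

  blocks : List Block
  blocks = map blockOf keys

  blocks-unique : Unique (concatMap proj₂ blocks)
  blocks-unique = subst Unique (cong concat (List.map-∘ keys))
    (Unique-concatMap⁺ pairKey keys-unique (λ {k} _ → blockOf-unique k)
                       (λ k∈ p∈ → proj₂ (blockOf-owned (keys-valid k∈) p∈)))

  blocks-canonical : ∀ {p} → p ∈ concatMap proj₂ blocks → Canonical p
  blocks-canonical p∈ with k , k∈ , p∈k ← find (Any.map⁻ (∈-concatMap⁻ proj₂ {xs = blocks} p∈)) =
    proj₁ (blockOf-owned (keys-valid k∈) p∈k)

  blocks-complete : ∀ {a b} → a < b → b ≤ n → parity (level a) ≡ parity (level b) →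
                    (suc a , b) ∈ concatMap proj₂ blocks
  blocks-complete a<b b≤n par with k , valid , p∈k ← located a<b b≤n par =
    ∈-concatMap⁺ proj₂ (Any.map⁺ (lose (valid⇒∈keys valid) p∈k))

  is45? : Decidable (λ (b : Block) → is45 (proj₁ b) ≡ true)
  is45? b = is45 (proj₁ b) Bool.≟ true

  hook-is45 : ∀ y → is45 (proj₁ (blockOf (hook y))) ≡ true
  hook-is45 y with prev y | next y
  ... | nothing | _       = refl
  ... | just _  | nothing = refl
  ... | just _  | just _  = refl

  rect-not45 : ∀ u v → is45 (proj₁ (blockOf (rect u v))) ≢ true
  rect-not45 u v with prev u | next v
  ... | nothing | nothing = λ ()
  ... | just _  | nothing = λ ()
  ... | nothing | just _  = λ ()
  ... | just _  | just _  = λ ()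

  blocks-count45 : length (filter is45? blocks) ≡ ups (suc n) ⊓ downs (suc n)
  blocks-count45 = begin
    length (filter is45? (map blockOf (hooks ++ rects)))
      ≡⟨ cong (length ∘ filter is45?) (List.map-++ blockOf hooks rects) ⟩
    length (filter is45? (map blockOf hooks ++ map blockOf rects))
      ≡⟨ cong length (List.filter-++ is45? (map blockOf hooks) (map blockOf rects)) ⟩
    length (filter is45? (map blockOf hooks) ++ filter is45? (map blockOf rects))
      ≡⟨ cong₂ (λ xs ys → length (xs ++ ys))
               (List.filter-all is45? {map blockOf hooks}
                  (All.map⁺ {f = blockOf} (All.map⁺ {f = hook} (All.universal hook-is45 _))))
               (List.filter-none is45? {map blockOf rects}
                  (All.map⁺ {f = blockOf} (All.map⁺ {f = uncurry rect} (All.universal (uncurry rect-not45) _)))) ⟩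
    length (map blockOf hooks ++ [])
      ≡⟨ cong length (List.++-identityʳ (map blockOf hooks)) ⟩
    length (map blockOf hooks)
      ≡⟨ trans (List.length-map blockOf hooks) (List.length-map hook (filter towardZero? (upTo (suc n)))) ⟩
    count towardZero? (suc n)
      ≡⟨ count-towardZero (suc n) ⟩
    ups (suc n) ⊓ downs (suc n) ∎
    where open ≡-Reasoning

prodFrom-+ : ∀ {n} (x : Vec Sign n) i m k → prodFrom x i (m + k) ≡ prodFrom x i m * prodFrom x (i + m) k
prodFrom-+ x i zero    k = cong (λ j → prodFrom x j k) (sym (ℕ.+-identityʳ i))
prodFrom-+ x i (suc m) k = begin
  at x i * prodFrom x (suc i) (m + k)
    ≡⟨ cong (at x i *_) (prodFrom-+ x (suc i) m k) ⟩
  at x i * (prodFrom x (suc i) m * prodFrom x (suc i + m) k)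
    ≡⟨ Sign.*-assoc (at x i) _ _ ⟨
  prodFrom x i (suc m) * prodFrom x (suc i + m) k
    ≡⟨ cong (λ j → prodFrom x i (suc m) * prodFrom x j k) (ℕ.+-suc i m) ⟨
  prodFrom x i (suc m) * prodFrom x (i + suc m) k
    ∎
  where open ≡-Reasoning

*-cancel-self : ∀ s t → s * (s * t) ≡ t
*-cancel-self s t = trans (sym (Sign.*-assoc s s t)) (cong (_* t) (Sign.s*s≡+ s))

minusOnePow-pair : ∀ a b → minusOnePow (suc a + b + 1) ≡ minusOnePow a * minusOnePow b
minusOnePow-pair a b = begin
  minusOnePow (suc a + b + 1)           ≡⟨ cong minusOnePow (ℕ.+-comm (suc a + b) 1) ⟩
  neg * (neg * minusOnePow (a + b))     ≡⟨ *-cancel-self neg (minusOnePow (a + b)) ⟩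
  minusOnePow (a + b)                   ≡⟨ minusOnePow-+ a b ⟩
  minusOnePow a * minusOnePow b         ∎
  where open ≡-Reasoning

module _ {n} (x : Vec Sign n) where

  form3-corners : ∀ {u v a b} → a < u → v < b →
                  s x (suc u) v ≡ pos → s x (suc a) b ≡ pos → s x (suc a) v ≡ neg → s x (suc u) b ≡ neg →
                  HasForm x f3 ((suc u , v) ∷ (suc a , v) ∷ (suc u , b) ∷ (suc a , b) ∷ [])
  form3-corners {u} {v} {a} {b} a<u v<b s₁ s₂ s₃ s₄ =
    subst₂ (λ i j → HasForm x f3 ((suc u , v) ∷ (i , v) ∷ (suc u , j) ∷ (i , j) ∷ [])) i≡ j≡
      (form3 (suc u) v (u ∸ a) (b ∸ v) (ℕ.m<n⇒0<n∸m a<u) (ℕ.m<n⇒0<n∸m v<b) (s≤s (ℕ.m∸n≤m u a)) s₁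
        (subst₂ (λ i j → s x i j ≡ pos) (sym i≡) (sym j≡) s₂)
        (subst (λ i → s x i v ≡ neg) (sym i≡) s₃)
        (subst (λ j → s x (suc u) j ≡ neg) (sym j≡) s₄))
    where
    i≡ : suc u ∸ (u ∸ a) ≡ suc a
    i≡ = ℕ.m∸[m∸n]≡n (s≤s (ℕ.<⇒≤ a<u))
    j≡ : v + (b ∸ v) ≡ b
    j≡ = ℕ.m+[n∸m]≡n (ℕ.<⇒≤ v<b)

  form5-corners : ∀ {w y z} → w < y → y < z → s x (suc w) z ≡ pos → s x (suc y) z ≡ neg → s x (suc w) y ≡ neg →
                  HasForm x f5 ((suc w , z) ∷ (suc y , z) ∷ (suc w , y) ∷ [])
  form5-corners {w} {y} {z} w<y y<z s₁ s₂ s₃ =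
    subst₂ (λ i j → HasForm x f5 ((suc w , z) ∷ (i , z) ∷ (suc w , j) ∷ [])) i≡ j≡
      (form5 (suc w) z (y ∸ w) (z ∸ y) (ℕ.m<n⇒0<n∸m w<y) (ℕ.m<n⇒0<n∸m y<z) (ℕ.m∸n≤m z y) s₁
        (subst (λ i → s x i z ≡ neg) (sym i≡) s₂)
        (subst (λ j → s x (suc w) j ≡ neg) (sym j≡) s₃))
    where
    i≡ : suc w + (y ∸ w) ≡ suc y
    i≡ = cong suc (ℕ.m+[n∸m]≡n (ℕ.<⇒≤ w<y))
    j≡ : z ∸ (z ∸ y) ≡ y
    j≡ = ℕ.m∸[m∸n]≡n (ℕ.<⇒≤ y<z)

module Partition {n} (x : Vec Sign n) where

  prefixSign : ℕ → Sign
  prefixSign k = s x 1 k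

  open Walk n prefixSign public

  s≡prefixSign* : ∀ {a b} → a ≤ b → s x (suc a) b ≡ prefixSign a * prefixSign b
  s≡prefixSign* {a} {b} a≤b = begin
    s x (suc a) b                                      ≡⟨ *-cancel-self (prefixSign a) _ ⟨
    prefixSign a * (prefixSign a * s x (suc a) b)      ≡⟨ cong (prefixSign a *_) split ⟨
    prefixSign a * prefixSign b                        ∎
    where
    open ≡-Reasoning
    split : prefixSign b ≡ prefixSign a * s x (suc a) b
    split = trans (cong (prodFrom x 1) (sym (ℕ.m+[n∸m]≡n a≤b))) (prodFrom-+ x 1 a (b ∸ a))

  s-same : ∀ {a b} → a < b → prefixSign a ≡ prefixSign b → s x (suc a) b ≡ pos
  s-same {b = b} a<b e =
    trans (s≡prefixSign* (ℕ.<⇒≤ a<b)) (trans (cong (_* prefixSign b) e) (Sign.s*s≡+ (prefixSign b)))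

  s-opposite : ∀ {a b} → a < b → prefixSign a ≡ opposite (prefixSign b) → s x (suc a) b ≡ neg
  s-opposite {b = b} a<b e =
    trans (s≡prefixSign* (ℕ.<⇒≤ a<b)) (trans (cong (_* prefixSign b) e) (Sign.opposite[s]*s≡- (prefixSign b)))

  canonical-sign : ∀ {a b} → a ≤ b →
                   (s x (suc a) b ≡ minusOnePow (suc a + b + 1)) ⇔ (parity (level a) ≡ parity (level b))
  canonical-sign {a} {b} a≤b = mk⇔
    (λ e → begin
      parity (level a)               ≡⟨ parity-level a ⟩
      prefixSign a * minusOnePow a   ≡⟨ *-transpose (prefixSign a) (prefixSign b) (minusOnePow a) (minusOnePow b)
                                          (trans (sym (s≡prefixSign* a≤b)) (trans e (minusOnePow-pair a b))) ⟩
      prefixSign b * minusOnePow b   ≡⟨ parity-level b ⟨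
      parity (level b)               ∎)
    (λ e → begin
      s x (suc a) b                  ≡⟨ s≡prefixSign* a≤b ⟩
      prefixSign a * prefixSign b    ≡⟨ *-transpose (prefixSign a) (minusOnePow a) (prefixSign b) (minusOnePow b)
                                          (trans (sym (parity-level a)) (trans e (parity-level b))) ⟩
      minusOnePow a * minusOnePow b  ≡⟨ minusOnePow-pair a b ⟨
      minusOnePow (suc a + b + 1)    ∎)
    where open ≡-Reasoning

  canonical⇒InK : ∀ {p} → Canonical p → InK x p
  canonical⇒InK {suc a , b} (a<b , b≤n , par) =
    s≤s z≤n , a<b , b≤n , Equivalence.from (canonical-sign (ℕ.<⇒≤ a<b)) par

  blockOf-form : ∀ {k} → Valid k → HasForm x (proj₁ (blockOf k)) (proj₂ (blockOf k))
  blockOf-form {rect u v} (inner u<v _ same _ _) with prev u in ea | next v in eb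
  ... | nothing | nothing = form1 (suc u) v (s-same u<v same)
  ... | just a  | nothing =
    form2 (suc u) v (suc a) v (s-same u<v same)
          (s-opposite (ℕ.<-trans (prev-< ea) u<v) (trans (prev-opposite ea) (cong opposite same)))
          (inj₁ (s≤s (ℕ.<⇒≤ (prev-< ea)) , refl))
  ... | nothing | just b  =
    form2 (suc u) v (suc u) b (s-same u<v same)
          (s-opposite (ℕ.<-trans u<v (next-< eb)) (trans same (≡opposite-sym (next-opposite eb))))
          (inj₂ (refl , ℕ.<⇒≤ (next-< eb)))
  ... | just a  | just b  =
    form3-corners x (prev-< ea) (next-< eb) (s-same u<v same)
      (s-same (ℕ.<-trans (prev-< ea) (ℕ.<-trans u<v (next-< eb)))
              (trans (trans (prev-opposite ea) (cong opposite same)) (sym (next-opposite eb))))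
      (s-opposite (ℕ.<-trans (prev-< ea) u<v) (trans (prev-opposite ea) (cong opposite same)))
      (s-opposite (ℕ.<-trans u<v (next-< eb)) (trans same (≡opposite-sym (next-opposite eb))))
  blockOf-form {hook y} (y≤n , toward) with prev y in ew | next y in ez
  ... | nothing | _ with () ← trans (sym ew) (proj₂ (towardZero⇒prev toward))
  ... | just w | nothing = form4 (suc w) y (s-opposite (prev-< ew) (prev-opposite ew))
  ... | just w | just z  =
    form5-corners x (prev-< ew) (next-< ez)
      (s-same (ℕ.<-trans (prev-< ew) (next-< ez)) (trans (prev-opposite ew) (sym (next-opposite ez))))
      (s-opposite (next-< ez) (≡opposite-sym (next-opposite ez)))
      (s-opposite (prev-< ew) (prev-opposite ew))

  ups≡α+1 : ups (suc n) ≡ α x + 1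
  ups≡α+1 = trans (cong (suc ∘ length ∘ filter up?) (sym (List.map-upTo suc n))) (ℕ.+-comm 1 (α x))

  downs≡β : downs (suc n) ≡ β x
  downs≡β = cong (length ∘ filter down?) (sym (List.map-upTo suc n))

mainTheorem3 : (n : ℕ) → 1 ≤ n → (x : Vec Sign n) → GoodPartition x
mainTheorem3 n _ x = record
  { blocks   = blocks
  ; forms    = All.map⁺ (All.tabulate (blockOf-form ∘ keys-valid))
  ; disjoint = blocks-unique
  ; sound    = λ _ → canonical⇒InK ∘ blocks-canonical
  ; complete = complete
  ; count45  = trans blocks-count45 (cong₂ _⊓_ ups≡α+1 downs≡β)
  }
  where
  open Partition x
  complete : ∀ p → InK x p → p ∈ concatMap proj₂ blocks
  complete (suc a , b) (_ , a<b , b≤n , sign) =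
    blocks-complete a<b b≤n (Equivalence.to (canonical-sign (ℕ.<⇒≤ a<b)) sign)
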